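{- Let $P$ be a permutation matrix and $X = (t_P, x_2, \dots, x_m)$ be a spanning oscillation of $P$ with $m \ge 6$. Then, removing $t = t_P$, the columns to the left of $t$, and the rows above $x_3$ (as well as all newly created empty rows or columns) does not make $P$ decomposable.
   Context: A permutation matrix has exactly one 1-entry in each row and column. A 0-1 matrix is decomposable if it has the form $\begin{pmatrix} A & \mathbf{0} \\ \mathbf{0} & B \end{pmatrix}$ or $\begin{pmatrix} \mathbf{0} & A \\ B & \mathbf{0} \end{pmatrix}$ for two matrices $A, B \neq \mathbf{0}$, where $\mathbf{0}$ denotes an all-0 matrix of the appropriate size. Let $\ell_P, r_P, t_P, b_P$ be the leftmost, rightmost, topmost, bottommost 1-entries of $P$. The permutation graph $G_P$ has the 1-entries of $P$ as vertices, with an edge between two 1-entries if one is below and to the left of the other. An oscillation is a sequence $(x_1,\dots,x_m)$ of distinct 1-entries forming an induced path in $G_P$. It is spanning if $\{x_1,x_2\}=\{\ell_P,t_P\}$ and $\{x_{m-1},x_m\}=\{b_P,r_P\}$. -}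

module Defs where

open import Data.Nat using (ℕ; zero; suc; _∸_)
open import Data.Fin using (Fin; toℕ; _<_; _≤_; _>_)
open import Data.Bool using (Bool; true)
open import Data.Product using (Σ; ∃; _×_; _,_; proj₁; proj₂)
open import Data.Sum using (_⊎_)
open import Relation.Binary.PropositionalEquality using (_≡_)
open import Relation.Nullary using (¬_)

-- An n×n 0-1 matrix: M i j is the entry in row i (rows numbered top to
-- bottom, starting at 0) and column j (numbered left to right).
Matrix01 : ℕ → Set
Matrix01 n = Fin n → Fin n → Bool

IsPermutationMatrix : {n : ℕ} → Matrix01 n → Set
IsPermutationMatrix {n} M =
  (∀ i → Σ (Fin n) λ j → M i j ≡ true × (∀ j′ → M i j′ ≡ true → j′ ≡ j)) ×
  (∀ j → Σ (Fin n) λ i → M i j ≡ true × (∀ i′ → M i′ j ≡ true → i′ ≡ i))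

Entry : ℕ → Set
Entry n = Fin n × Fin n

row col : {n : ℕ} → Entry n → Fin n
row = proj₁
col = proj₂

OneEntry : {n : ℕ} → Matrix01 n → Entry n → Set
OneEntry M (i , j) = M i j ≡ true

IsTopmost IsBottommost IsLeftmost IsRightmost : {n : ℕ} → Matrix01 n → Entry n → Set
IsTopmost    M e = OneEntry M e × (∀ e′ → OneEntry M e′ → row e ≤ row e′)
IsBottommost M e = OneEntry M e × (∀ e′ → OneEntry M e′ → row e′ ≤ row e)
IsLeftmost   M e = OneEntry M e × (∀ e′ → OneEntry M e′ → col e ≤ col e′)
IsRightmost  M e = OneEntry M e × (∀ e′ → OneEntry M e′ → col e′ ≤ col e)

BelowLeft : {n : ℕ} → Entry n → Entry n → Set
BelowLeft e e′ = row e > row e′ × col e < col e′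

Adjacent : {n : ℕ} → Entry n → Entry n → Set
Adjacent e e′ = BelowLeft e e′ ⊎ BelowLeft e′ e

-- x : ℕ → Entry n, of which only x 0 , … , x (m ∸ 1) are used
-- (0-indexed: x k is the paper's x_{k+1}).
-- An oscillation: distinct 1-entries forming an induced path in G_P.
IsOscillation : {n : ℕ} → Matrix01 n → (m : ℕ) → (ℕ → Entry n) → Set
IsOscillation M m x =
  (∀ k → k Data.Nat.< m → OneEntry M (x k)) ×
  (∀ k l → k Data.Nat.< m → l Data.Nat.< m → x k ≡ x l → k ≡ l) ×
  (∀ k l → k Data.Nat.< m → l Data.Nat.< m →
     (Adjacent (x k) (x l) → (l ≡ suc k ⊎ k ≡ suc l)) ×
     ((l ≡ suc k ⊎ k ≡ suc l) → Adjacent (x k) (x l)))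

SameUnorderedPair : {A : Set} → A → A → A → A → Set
SameUnorderedPair a b c d = (a ≡ c × b ≡ d) ⊎ (a ≡ d × b ≡ c)

IsSpanningOscillation : {n : ℕ} → Matrix01 n → (m : ℕ) → (ℕ → Entry n) → Set
IsSpanningOscillation M m x =
  IsOscillation M m x ×
  (∀ l t → IsLeftmost M l → IsTopmost M t → SameUnorderedPair (x 0) (x 1) l t) ×
  (∀ b r → IsBottommost M b → IsRightmost M r →
     SameUnorderedPair (x (m ∸ 2)) (x (m ∸ 1)) b r)

-- Decomposability of the matrix obtained from an n×n matrix by keeping only
-- the 1-entries in S and deleting all rows / columns that then are empty.
-- A cut of the rows of the reduced matrix is a threshold a on the original
-- row indices (rows < a on top), likewise b for columns.
DecomposableSub : {n : ℕ} → (Entry n → Set) → Set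
DecomposableSub {n} S =
  Σ ℕ λ a → Σ ℕ λ b →
    -- form ( A 0 ; 0 B )
    ( (∀ e → S e → toℕ (row e) Data.Nat.< a → toℕ (col e) Data.Nat.< b) ×
      (∀ e → S e → a Data.Nat.≤ toℕ (row e) → b Data.Nat.≤ toℕ (col e)) ×
      (∃ λ e → S e × toℕ (row e) Data.Nat.< a × toℕ (col e) Data.Nat.< b) ×
      (∃ λ e → S e × a Data.Nat.≤ toℕ (row e) × b Data.Nat.≤ toℕ (col e)) )
    ⊎
    -- form ( 0 A ; B 0 )
    ( (∀ e → S e → toℕ (row e) Data.Nat.< a → b Data.Nat.≤ toℕ (col e)) ×
      (∀ e → S e → a Data.Nat.≤ toℕ (row e) → toℕ (col e) Data.Nat.< b) ×
      (∃ λ e → S e × toℕ (row e) Data.Nat.< a × b Data.Nat.≤ toℕ (col e)) ×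
      (∃ λ e → S e × a Data.Nat.≤ toℕ (row e) × toℕ (col e) Data.Nat.< b) )

Decomposable : {n : ℕ} → Matrix01 n → Set
Decomposable M = DecomposableSub (OneEntry M)

RemainingAfterRemoval : {n : ℕ} → Matrix01 n → (t y : Entry n) → Entry n → Set
RemainingAfterRemoval M t y e =
  OneEntry M e ×
  ¬ (row e ≡ row t) × ¬ (col e ≡ col t) ×
  ¬ (col e < col t) ×
  ¬ (row e < row y)

{-# OPTIONS --safe #-}
-- (Indices 0-based, as in Defs.)  As x₀ = t is topmost, x₁ = ℓ is leftmost.  Hence
-- x₂ lies above x₁, while every later xᵢ lies weakly below x₁ and to the right of t,
-- since otherwise it would be adjacent to x₁ or to t.  So x₂ , … , x_{m-1} survive
-- the removal, and x₂ is a highest survivor.  No edge of G_P joins the two blocks of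
-- a block-diagonal split, so the path x₂ , x₃ , … stays in the upper block, which
-- then contains the rightmost entry and leaves the lower block empty.  In an
-- anti-diagonal split x₂ is in the upper block and the bottommost entry (x_{m-2} or
-- x_{m-1}) in the lower one, and such a pair is an edge of G_P between
-- non-consecutive entries of the oscillation.
module Submission where

open import Defs
open import Data.Nat using (ℕ; zero; suc; _+_; _≤_; _<_; z≤n; s≤s; _<?_)
open import Data.Nat.Properties
  using (≤-refl; ≤-trans; <-trans; <⇒≤; ≤-<-trans; <-≤-trans; n≤1+n; n<1+n;
         ≮⇒≥; ≤∧≢⇒<; <⇒≢; <⇒≱; ≤⇒≯; <-asym)
open import Data.Fin using (toℕ; fromℕ) renaming (zero to fzero)
open import Data.Fin.Properties using (toℕ-injective; ≤fromℕ)
open import Data.Product using (Σ; ∃-syntax; _×_; _,_; proj₁; proj₂)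
open import Data.Sum using (_⊎_; inj₁; inj₂)
open import Data.Empty using (⊥-elim)
open import Relation.Nullary using (¬_; yes; no; contradiction)
open import Relation.Binary.PropositionalEquality using (_≡_; refl; sym; trans; cong; subst)

row# col# : ∀ {n} → Entry n → ℕ
row# e = toℕ (row e)
col# e = toℕ (col e)

DiagonalCut AntiDiagonalCut : ∀ {n} → (Entry n → Set) → ℕ → ℕ → Set
DiagonalCut S a b =
  (∀ e → S e → row# e < a → col# e < b) ×
  (∀ e → S e → a ≤ row# e → b ≤ col# e) ×
  (∃[ e ] S e × row# e < a × col# e < b) ×
  (∃[ e ] S e × a ≤ row# e × b ≤ col# e)
AntiDiagonalCut S a b =
  (∀ e → S e → row# e < a → b ≤ col# e) ×
  (∀ e → S e → a ≤ row# e → col# e < b) ×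
  (∃[ e ] S e × row# e < a × b ≤ col# e) ×
  (∃[ e ] S e × a ≤ row# e × col# e < b)

module _ {n} {S : Entry n → Set} {a b : ℕ} where

  diagonalCut-adjacent-upper : DiagonalCut S a b → ∀ {e e′} → S e → S e′ →
    Adjacent e e′ → row# e < a → row# e′ < a
  diagonalCut-adjacent-upper (upper , lower , _) {e} {e′} s s′ adj e↑ with row# e′ <? a
  ... | yes e′↑ = e′↑
  ... | no e′↓ with adj
  ...   | inj₁ (e′<e , _) = contradiction (<-trans e′<e e↑) e′↓
  ...   | inj₂ (_ , e′<e) = ⊥-elim (<⇒≱ (<-trans e′<e (upper e s e↑)) (lower e′ s′ (≮⇒≥ e′↓)))

  antiDiagonalCut-belowLeft : AntiDiagonalCut S a b → ∀ {e e′} → S e → S e′ →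
    row# e < a → a ≤ row# e′ → BelowLeft e′ e
  antiDiagonalCut-belowLeft (upper , lower , _) s s′ e↑ e′↓ =
    <-≤-trans e↑ e′↓ , <-≤-trans (lower _ s′ e′↓) (upper _ s e↑)

module _ {n} {P : Matrix01 n} (perm : IsPermutationMatrix P) where

  sameRow⇒≡ : ∀ {e e′} → OneEntry P e → OneEntry P e′ → row# e ≡ row# e′ → e ≡ e′
  sameRow⇒≡ {i , j} {_ , j′} o o′ eq with toℕ-injective eq
  ... | refl = cong (i ,_) (trans (unique j o) (sym (unique j′ o′)))
    where unique = proj₂ (proj₂ (proj₁ perm i))

  sameCol⇒≡ : ∀ {e e′} → OneEntry P e → OneEntry P e′ → col# e ≡ col# e′ → e ≡ e′
  sameCol⇒≡ {i , j} {i′ , _} o o′ eq with toℕ-injective eq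
  ... | refl = cong (_, j) (trans (unique i o) (sym (unique i′ o′)))
    where unique = proj₂ (proj₂ (proj₂ perm j))

module _ {n} {P : Matrix01 (suc n)} (perm : IsPermutationMatrix P) where

  leftmost : Σ (Entry (suc n)) (IsLeftmost P)
  leftmost = (proj₁ (proj₂ perm fzero) , fzero) ,
             proj₁ (proj₂ (proj₂ perm fzero)) , λ _ _ → z≤n

  rightmost : Σ (Entry (suc n)) (IsRightmost P)
  rightmost = (proj₁ (proj₂ perm (fromℕ n)) , fromℕ n) ,
              proj₁ (proj₂ (proj₂ perm (fromℕ n))) , λ e _ → ≤fromℕ (col e)

  bottommost : Σ (Entry (suc n)) (IsBottommost P)
  bottommost = (fromℕ n , proj₁ (proj₁ perm (fromℕ n))) ,
               proj₁ (proj₂ (proj₁ perm (fromℕ n))) , λ e _ → ≤fromℕ (row e)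

  module _ {k x} (span : IsSpanningOscillation P (6 + k) x) where

    private
      ends = proj₂ (proj₂ span) _ _ (proj₂ bottommost) (proj₂ rightmost)

    spanning-leftmost : IsTopmost P (x 0) → IsLeftmost P (x 1)
    spanning-leftmost top with proj₁ (proj₂ span) _ _ (proj₂ leftmost) top
    ... | inj₂ (_ , x₁≡ℓ) = subst (IsLeftmost P) (sym x₁≡ℓ) (proj₂ leftmost)
    ... | inj₁ (_ , x₁≡x₀) with proj₁ (proj₂ (proj₁ span)) 1 0 (s≤s (s≤s z≤n)) (s≤s z≤n) x₁≡x₀
    ...   | ()

    spanning-bottommost : ∃[ j ] 4 + j < 6 + k × IsBottommost P (x (4 + j))
    spanning-bottommost with ends
    ... | inj₁ (eq , _) = k , n≤1+n _ , subst (IsBottommost P) (sym eq) (proj₂ bottommost)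
    ... | inj₂ (_ , eq) = suc k , ≤-refl , subst (IsBottommost P) (sym eq) (proj₂ bottommost)

    spanning-rightmost : ∃[ j ] 4 + j < 6 + k × IsRightmost P (x (4 + j))
    spanning-rightmost with ends
    ... | inj₁ (_ , eq) = suc k , ≤-refl , subst (IsRightmost P) (sym eq) (proj₂ rightmost)
    ... | inj₂ (eq , _) = k , n≤1+n _ , subst (IsRightmost P) (sym eq) (proj₂ rightmost)

module TopmostStart {n} {P : Matrix01 n} (perm : IsPermutationMatrix P) {m x}
  (osc : IsOscillation P m x) (2<m : 2 < m)
  (top : IsTopmost P (x 0)) (left : IsLeftmost P (x 1)) where

  private
    1<m : 1 < m
    1<m = <-trans (n<1+n 1) 2<m

    0<m : 0 < m
    0<m = <-trans (n<1+n 0) 1<m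

    one : ∀ {i} → i < m → OneEntry P (x i)
    one = proj₁ osc _

    adjacent⇒consecutive : ∀ {i j} → i < m → j < m → Adjacent (x i) (x j) →
      j ≡ suc i ⊎ i ≡ suc j
    adjacent⇒consecutive p q = proj₁ (proj₂ (proj₂ osc) _ _ p q)

    consecutive-adjacent : ∀ {i} → suc i < m → Adjacent (x i) (x (suc i))
    consecutive-adjacent p = proj₂ (proj₂ (proj₂ osc) _ _ (<-trans (n<1+n _) p) p) (inj₁ refl)

    sameRow⇒sameIndex : ∀ {i j} → i < m → j < m → row# (x i) ≡ row# (x j) → i ≡ j
    sameRow⇒sameIndex p q eq = proj₁ (proj₂ osc) _ _ p q (sameRow⇒≡ perm (one p) (one q) eq)

    sameCol⇒sameIndex : ∀ {i j} → i < m → j < m → col# (x i) ≡ col# (x j) → i ≡ j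
    sameCol⇒sameIndex p q eq = proj₁ (proj₂ osc) _ _ p q (sameCol⇒≡ perm (one p) (one q) eq)

  x₂-above-x₁ : row# (x 2) < row# (x 1)
  x₂-above-x₁ with proj₂ (proj₂ (proj₂ osc) 1 2 1<m 2<m) (inj₁ refl)
  ... | inj₁ (x₂<x₁ , _) = x₂<x₁
  ... | inj₂ (_ , x₂-left) = ⊥-elim (<⇒≱ x₂-left (proj₂ left _ (one 2<m)))

  x₁-above-later : ∀ k → 3 + k < m → row# (x 1) ≤ row# (x (3 + k))
  x₁-above-later k p with row# (x (3 + k)) <? row# (x 1)
  ... | no q = ≮⇒≥ q
  ... | yes q with adjacent⇒consecutive 1<m p (inj₁ (q , x₁-left))
    where
    x₁-left : col# (x 1) < col# (x (3 + k))
    x₁-left = ≤∧≢⇒< (proj₂ left _ (one p)) λ eq → contradiction (sameCol⇒sameIndex 1<m p eq) λ ()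
  ... | inj₁ ()
  ... | inj₂ ()

  x₂-above-later : ∀ k → 2 + k < m → row# (x 2) ≤ row# (x (2 + k))
  x₂-above-later zero _ = ≤-refl
  x₂-above-later (suc k) p = <⇒≤ (<-≤-trans x₂-above-x₁ (x₁-above-later k p))

  x₀-above-later : ∀ k → 2 + k < m → row# (x 0) < row# (x (2 + k))
  x₀-above-later k p =
    ≤∧≢⇒< (proj₂ top _ (one p)) λ eq → contradiction (sameRow⇒sameIndex 0<m p eq) λ ()

  x₀-left-of-later : ∀ k → 2 + k < m → col# (x 0) < col# (x (2 + k))
  x₀-left-of-later k p with col# (x (2 + k)) <? col# (x 0)
  ... | no q = ≤∧≢⇒< (≮⇒≥ q) λ eq → contradiction (sameCol⇒sameIndex 0<m p eq) λ ()
  ... | yes q with adjacent⇒consecutive p 0<m (inj₁ (x₀-above-later k p , q))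
  ...   | inj₁ ()
  ...   | inj₂ ()

  Remaining : Entry n → Set
  Remaining = RemainingAfterRemoval P (x 0) (x 2)

  later-remaining : ∀ k → 2 + k < m → Remaining (x (2 + k))
  later-remaining k p =
    one p ,
    (λ eq → <⇒≢ (x₀-above-later k p) (sym (cong toℕ eq))) ,
    (λ eq → <⇒≢ (x₀-left-of-later k p) (sym (cong toℕ eq))) ,
    <-asym (x₀-left-of-later k p) ,
    ≤⇒≯ (x₂-above-later k p)

  remaining-below-x₂ : ∀ {e} → Remaining e → row# (x 2) ≤ row# e
  remaining-below-x₂ s = ≮⇒≥ (proj₂ (proj₂ (proj₂ (proj₂ s))))

  ¬diagonalCut : ∀ {j} → 2 + j < m → IsRightmost P (x (2 + j)) →
    ∀ {a b} → ¬ DiagonalCut Remaining a b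
  ¬diagonalCut {j} p right {a} cut@(upper , _ , (_ , s , e↑ , _) , (e′ , s′ , _ , e′→)) =
    <⇒≱ (upper _ (later-remaining j p) (later-upper j p)) (≤-trans e′→ (proj₂ right e′ (proj₁ s′)))
    where
    later-upper : ∀ k → 2 + k < m → row# (x (2 + k)) < a
    later-upper zero _ = ≤-<-trans (remaining-below-x₂ s) e↑
    later-upper (suc k) q = diagonalCut-adjacent-upper cut
      (later-remaining k q′) (later-remaining (suc k) q) (consecutive-adjacent q) (later-upper k q′)
      where q′ = <-trans (n<1+n _) q

  ¬antiDiagonalCut : ∀ {j} → 4 + j < m → IsBottommost P (x (4 + j)) →
    ∀ {a b} → ¬ AntiDiagonalCut Remaining a b
  ¬antiDiagonalCut {j} p bottom cut@(_ , _ , (_ , s , e↑ , _) , (e′ , s′ , e′↓ , _))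
    with adjacent⇒consecutive p 2<m (inj₁ (antiDiagonalCut-belowLeft cut
           (later-remaining 0 2<m) (later-remaining (2 + j) p)
           (≤-<-trans (remaining-below-x₂ s) e↑) (≤-trans e′↓ (proj₂ bottom e′ (proj₁ s′)))))
  ... | inj₁ ()
  ... | inj₂ ()

lemma3p3 : (n : ℕ) (P : Matrix01 n) → IsPermutationMatrix P →
    (m : ℕ) (x : ℕ → Entry n) → IsSpanningOscillation P m x → 6 ≤ m →
    IsTopmost P (x 0) →
    ¬ DecomposableSub (RemainingAfterRemoval P (x 0) (x 2))
lemma3p3 zero _ _ _ x _ _ _ with x 0
... | () , _
lemma3p3 (suc n) P perm .(6 + k) x span (s≤s (s≤s (s≤s (s≤s (s≤s (s≤s (z≤n {k}))))))) top = λ where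
    (_ , _ , inj₁ cut) → let (_ , p , right) = spanning-rightmost perm span in ¬diagonalCut p right cut
    (_ , _ , inj₂ cut) → let (_ , p , bottom) = spanning-bottommost perm span in ¬antiDiagonalCut p bottom cut
  where
  open TopmostStart perm (proj₁ span) (s≤s (s≤s (s≤s z≤n))) top (spanning-leftmost perm span top)
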